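{- Let $\mathfrak{A}=(A;=,+,V_2)$ be a non-standard model of $\mathrm{BA}_2$. Then each galaxy of $\mathfrak{A}$ contains at most one hypernumber; equivalently, if $x$ is a hypernumber and $t$ is a nonzero standard natural number, then neither $x+t$ nor $x-t$ (when it exists) is a hypernumber.
   Context: $\mathrm{BA}_2=\mathrm{Th}(\mathbb{N};=,+,V_2)$, where $V_2(x)$ is the largest power of $2$ dividing $x$ for $x\neq0$ and $V_2(0)=0$. Standard elements of a model are $0,1,1+1,\ldots$; others are non-standard. A non-standard $x$ is a hypernumber if $V_2(x)$ is non-standard. For non-standard $a,b$, $a\sim b$ iff their difference is standard; the galaxy of $a$ is its $\sim$-class. -}

module Defs where

open import Data.Nat using (ℕ; zero; suc; _+_; _*_; _%_; _/_)
open import Data.Fin using (Fin) renaming (zero to fz; suc to fs)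
open import Data.Product using (Σ; _×_; ∃)
open import Data.Sum using (_⊎_)
open import Data.Empty using (⊥)
open import Relation.Nullary using (¬_)
open import Relation.Binary.PropositionalEquality using (_≡_)

-- V₂ on ℕ: largest power of 2 dividing x (x ≠ 0), and V₂ 0 = 0.
-- Computed with fuel (the number of halvings is ≤ x, so fuel x suffices).

v2-fuel : ℕ → ℕ → ℕ
v2-fuel zero    _       = 1
v2-fuel (suc f) zero    = 0
v2-fuel (suc f) (suc m) with (suc m) % 2
... | zero  = 2 * v2-fuel f ((suc m) / 2)
... | suc _ = 1

V₂ : ℕ → ℕ
V₂ zero    = 0
V₂ (suc m) = v2-fuel (suc m) (suc m)

record Structure : Set₁ where
  field
    Carrier : Set
    _⊕_     : Carrier → Carrier → Carrier
    v2      : Carrier → Carrier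

ℕ-struct : Structure
ℕ-struct = record { Carrier = ℕ ; _⊕_ = _+_ ; v2 = V₂ }

-- First-order syntax (de Bruijn variables), language {=, +, V₂}.
-- Connectives: ⊥, ⇒, ∧, ∀ (a complete set classically; ∨, ¬, ∃ are
-- the usual abbreviations).

data Term (n : ℕ) : Set where
  var  : Fin n → Term n
  plus : Term n → Term n → Term n
  V    : Term n → Term n

data Formula (n : ℕ) : Set where
  _≐_  : Term n → Term n → Formula n
  falsum : Formula n
  _⇒_  : Formula n → Formula n → Formula n
  _∧'_ : Formula n → Formula n → Formula n
  all  : Formula (suc n) → Formula n

Sentence : Set
Sentence = Formula 0

module _ (𝔄 : Structure) where
  open Structure 𝔄

  extend : ∀ {n} → (Fin n → Carrier) → Carrier → Fin (suc n) → Carrier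
  extend ρ a fz     = a
  extend ρ a (fs i) = ρ i

  evalT : ∀ {n} → (Fin n → Carrier) → Term n → Carrier
  evalT ρ (var i)    = ρ i
  evalT ρ (plus s t) = evalT ρ s ⊕ evalT ρ t
  evalT ρ (V t)      = v2 (evalT ρ t)

  Sat : ∀ {n} → (Fin n → Carrier) → Formula n → Set
  Sat ρ (s ≐ t)   = evalT ρ s ≡ evalT ρ t
  Sat ρ falsum    = ⊥
  Sat ρ (φ ⇒ ψ)   = Sat ρ φ → Sat ρ ψ
  Sat ρ (φ ∧' ψ)  = Sat ρ φ × Sat ρ ψ
  Sat ρ (all φ)   = (a : Carrier) → Sat (extend ρ a) φ

emptyEnv : {A : Set} → Fin 0 → A
emptyEnv ()

_⊨_ : Structure → Sentence → Set
𝔄 ⊨ φ = Sat 𝔄 emptyEnv φ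

IsModelBA₂ : Structure → Set
IsModelBA₂ 𝔄 = (φ : Sentence) → ℕ-struct ⊨ φ → 𝔄 ⊨ φ

-- Standard elements 0, 1, 1+1, … of a structure.  0 and 1 are not
-- symbols of the language; they are the elements defined (as in ℕ) by
--   zero: x + x = x;
--   one : x ≠ 0 and x is not the sum of two nonzero elements.

module Std (𝔄 : Structure) where
  open Structure 𝔄

  IsZero : Carrier → Set
  IsZero x = x ⊕ x ≡ x

  IsOne : Carrier → Set
  IsOne x = ¬ IsZero x × ((a b : Carrier) → x ≡ a ⊕ b → IsZero a ⊎ IsZero b)

  IsNumeral : ℕ → Carrier → Set
  IsNumeral zero    x = IsZero x
  IsNumeral (suc n) x = Σ Carrier λ y → Σ Carrier λ o →
                          IsNumeral n y × IsOne o × x ≡ y ⊕ o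

  Standard : Carrier → Set
  Standard x = ∃ λ n → IsNumeral n x

  NonStandard : Carrier → Set
  NonStandard x = ¬ Standard x

  NonStandardModel : Set
  NonStandardModel = IsModelBA₂ 𝔄 × ∃ NonStandard

  Hypernumber : Carrier → Set
  Hypernumber x = NonStandard x × NonStandard (v2 x)

  _∼_ : Carrier → Carrier → Set
  a ∼ b = NonStandard a × NonStandard b ×
          (Σ Carrier λ t → Standard t × (a ≡ b ⊕ t ⊎ b ≡ a ⊕ t))

-- In ℕ, for n ≥ 1 and every y, V₂ y ≤ n or V₂ (y + n) ≤ n: a power of 2 exceeding n
-- cannot divide both y and y + n.  For each standard n this is a first-order sentence
-- (n is a numeral, "≤ n" a finite disjunction of numerals), so it holds in every model
-- of BA₂, and therefore y and y + n are never both hypernumbers.  For n = 0 there is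
-- nothing to prove since 0 is an additive identity.
module Submission where

open import Defs
open import Data.Nat
open import Data.Nat.Properties
open import Data.Nat.DivMod
open import Data.Nat.Induction using (<-wellFounded)
open import Induction.WellFounded using (Acc; acc)
open import Data.Fin using (Fin) renaming (zero to fz; suc to fs)
open import Data.Product using (_,_)
open import Data.Sum using (_⊎_; inj₁; inj₂)
open import Data.Empty using (⊥; ⊥-elim)
open import Function using (_∘_)
open import Relation.Nullary using (¬_; yes; no)
open import Relation.Binary.PropositionalEquality

v2-fuel-irrelevant : ∀ {f g} n .{{_ : NonZero n}} → n ≤ f → n ≤ g → v2-fuel f n ≡ v2-fuel g n
v2-fuel-irrelevant {suc f} {suc g} (suc m) (s≤s m≤f) (s≤s m≤g) with suc m % 2 in parity
... | suc _ = refl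
... | zero  = cong (2 *_)
  (v2-fuel-irrelevant (suc m / 2) {{>-nonZero (m≥n⇒m/n>0 (even⇒2≤ m parity))}}
    (≤-trans half≤m m≤f) (≤-trans half≤m m≤g))
  where
  half≤m : suc m / 2 ≤ m
  half≤m = ≤-pred (m/n<m (suc m) 2 (s≤s (s≤s z≤n)))
  even⇒2≤ : ∀ m → suc m % 2 ≡ 0 → 2 ≤ suc m
  even⇒2≤ (suc m) _ = s≤s (s≤s z≤n)

V₂-odd : ∀ m → V₂ (1 + m * 2) ≡ 1
V₂-odd m with suc (m * 2) % 2 in parity
... | suc _ = refl
... | zero  with () ← trans (sym ([m+kn]%n≡m%n 1 m 2)) parity

V₂-double : ∀ m → V₂ (m * 2) ≡ V₂ m * 2
V₂-double zero    = refl
V₂-double (suc m) with suc m * 2 % 2 in parity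
... | suc _ with () ← trans (sym (m*n%n≡0 (suc m) 2)) parity
... | zero  = begin
  2 * v2-fuel (suc (m * 2)) (suc m * 2 / 2)
    ≡⟨ cong (λ h → 2 * v2-fuel (suc (m * 2)) h) (m*n/n≡m (suc m) 2) ⟩
  2 * v2-fuel (suc (m * 2)) (suc m)
    ≡⟨ cong (2 *_) (v2-fuel-irrelevant (suc m) (s≤s (m≤m*n m 2)) ≤-refl) ⟩
  2 * V₂ (suc m)
    ≡⟨ *-comm 2 (V₂ (suc m)) ⟩
  V₂ (suc m) * 2
    ∎
  where open ≡-Reasoning

data EvenOdd : ℕ → Set where
  even : ∀ m → EvenOdd (m * 2)
  odd  : ∀ m → EvenOdd (1 + m * 2)

evenOdd : ∀ n → EvenOdd n
evenOdd zero = even 0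
evenOdd (suc n) with evenOdd n
... | even m = odd m
... | odd m  = even (suc m)

V₂≤n⊎V₂[y+n]≤n : ∀ n .{{_ : NonZero n}} y → V₂ y ≤ n ⊎ V₂ (y + n) ≤ n
V₂≤n⊎V₂[y+n]≤n n = go n (<-wellFounded n)
  where
  go : ∀ n .{{_ : NonZero n}} → Acc _<_ n → ∀ y → V₂ y ≤ n ⊎ V₂ (y + n) ≤ n
  go n (acc rec) y with evenOdd y | evenOdd n
  ... | odd m  | _     = inj₁ (subst (_≤ n) (sym (V₂-odd m)) (>-nonZero⁻¹ n))
  ... | even m | odd k =
    inj₂ (subst (_≤ n) (sym (trans (cong V₂ y+n-odd) (V₂-odd (m + k)))) (>-nonZero⁻¹ n))
    where
    y+n-odd : m * 2 + (1 + k * 2) ≡ 1 + (m + k) * 2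
    y+n-odd = trans (+-suc (m * 2) (k * 2)) (cong suc (sym (*-distribʳ-+ 2 m k)))
  ... | even m | even k@(suc _) with go k (rec (m<m*n k 2 (s≤s (s≤s z≤n)))) m
  ...   | inj₁ h = inj₁ (subst (_≤ k * 2) (sym (V₂-double m)) (*-monoˡ-≤ 2 h))
  ...   | inj₂ h = inj₂ (subst (_≤ k * 2) (sym V₂[y+n]≡V₂[m+k]*2) (*-monoˡ-≤ 2 h))
    where
    V₂[y+n]≡V₂[m+k]*2 : V₂ (m * 2 + k * 2) ≡ V₂ (m + k) * 2
    V₂[y+n]≡V₂[m+k]*2 = trans (cong V₂ (sym (*-distribʳ-+ 2 m k))) (V₂-double (m + k))

wk : ∀ {m} → Term m → Term (suc m)
wk (var i)    = var (fs i)
wk (plus s t) = plus (wk s) (wk t)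
wk (V t)      = V (wk t)

evalT-wk : (𝔄 : Structure) → ∀ {m} (ρ : Fin m → Structure.Carrier 𝔄) a t →
           evalT 𝔄 (extend 𝔄 ρ a) (wk t) ≡ evalT 𝔄 ρ t
evalT-wk 𝔄 ρ a (var i)    = refl
evalT-wk 𝔄 ρ a (plus s t) = cong₂ (Structure._⊕_ 𝔄) (evalT-wk 𝔄 ρ a s) (evalT-wk 𝔄 ρ a t)
evalT-wk 𝔄 ρ a (V t)      = cong (Structure.v2 𝔄) (evalT-wk 𝔄 ρ a t)

evalT-wk² : (𝔄 : Structure) → ∀ {m} (ρ : Fin m → Structure.Carrier 𝔄) a b t →
            evalT 𝔄 (extend 𝔄 (extend 𝔄 ρ a) b) (wk (wk t)) ≡ evalT 𝔄 ρ t
evalT-wk² 𝔄 ρ a b t = trans (evalT-wk 𝔄 (extend 𝔄 ρ a) b (wk t)) (evalT-wk 𝔄 ρ a t)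

-- Classical abbreviations: satisfying them means satisfying the intended connective
-- only up to double negation, hence the ¬ ¬ in the conclusions of the transfer lemmas.
infix 30 ¬'_

¬'_ : ∀ {m} → Formula m → Formula m
¬' φ = φ ⇒ falsum

_∨'_ : ∀ {m} → Formula m → Formula m → Formula m
φ ∨' ψ = ¬' φ ⇒ ψ

ex : ∀ {m} → Formula (suc m) → Formula m
ex φ = ¬' all (¬' φ)

isZeroF : ∀ {m} → Term m → Formula m
isZeroF s = plus s s ≐ s

isOneF : ∀ {m} → Term m → Formula m
isOneF s = ¬' isZeroF s ∧'
  all (all ((wk (wk s) ≐ plus (var (fs fz)) (var fz)) ⇒ (isZeroF (var (fs fz)) ∨' isZeroF (var fz))))

-- numeralF k o z : z = 1 + ⋯ + 1 (k times), with o standing for 1.  The unit is a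
-- parameter rather than quantified inside, since IsOne cannot be recovered from the
-- (double-negated) satisfaction of isOneF.
numeralF : ∀ {m} → ℕ → Term m → Term m → Formula m
numeralF zero    o z = isZeroF z
numeralF (suc k) o z = ex (numeralF k (wk o) (var fz) ∧' (wk z ≐ plus (var fz) (wk o)))

standard≤F : ∀ {m} → ℕ → Term m → Term m → Formula m
standard≤F zero    o z = numeralF zero o z
standard≤F (suc n) o z = numeralF (suc n) o z ∨' standard≤F n o z

zero-identityʳ : Sentence
zero-identityʳ = all (all (isZeroF (var fz) ⇒ (plus (var (fs fz)) (var fz) ≐ var (fs fz))))

one-unique : Sentence
one-unique = all (all (isOneF (var (fs fz)) ⇒ (isOneF (var fz) ⇒ (var (fs fz) ≐ var fz))))

V₂-small-near : ℕ → Sentence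
V₂-small-near k = all (all (all (isOneF o ⇒ (numeralF (suc k) o t ⇒
  (standard≤F (suc k) o (V (plus y t)) ∨' standard≤F (suc k) o (V y))))))
  where
  o t y : Term 3
  o = var (fs (fs fz))
  t = var (fs fz)
  y = var fz

module InNat where
  ⟦_⟧ : ∀ {m} → Term m → (Fin m → ℕ) → ℕ
  ⟦ s ⟧ ρ = evalT ℕ-struct ρ s

  _⊩_ : ∀ {m} → (Fin m → ℕ) → Formula m → Set
  _⊩_ = Sat ℕ-struct

  m+m≡m⇒m≡0 : ∀ {m} → m + m ≡ m → m ≡ 0
  m+m≡m⇒m≡0 {m} e = +-cancelˡ-≡ m m 0 (trans e (sym (+-identityʳ m)))

  isOne⇒≡1 : ∀ {m} (ρ : Fin m → ℕ) s → ρ ⊩ isOneF s → ⟦ s ⟧ ρ ≡ 1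
  isOne⇒≡1 ρ s (nonzero , indecomposable) =
    go (⟦ s ⟧ ρ) nonzero λ a b e → indecomposable a b (trans (evalT-wk² ℕ-struct ρ a b s) e)
    where
    go : ∀ v → ¬ (v + v ≡ v) → (∀ a b → v ≡ a + b → ¬ (a + a ≡ a) → b + b ≡ b) → v ≡ 1
    go zero          nonzero _ = ⊥-elim (nonzero refl)
    go (suc zero)    _       _ = refl
    go (suc (suc v)) _       indecomposable with () ← m+m≡m⇒m≡0 (indecomposable 1 (suc v) refl λ ())

  numeral⇒≡ : ∀ {m} k (ρ : Fin m → ℕ) o z →
              ⟦ o ⟧ ρ ≡ 1 → ρ ⊩ numeralF k o z → ⟦ z ⟧ ρ ≡ k
  numeral⇒≡ zero    ρ o z _   isZero = m+m≡m⇒m≡0 isZero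
  numeral⇒≡ (suc k) ρ o z o≡1 ¬¬numeral with ⟦ z ⟧ ρ ≟ suc k
  ... | yes z≡1+k = z≡1+k
  ... | no  z≢1+k = ⊥-elim (¬¬numeral λ a (numeral , e) → z≢1+k (successor a numeral e))
    where
    open ≡-Reasoning
    successor : ∀ a → let ρ′ = extend ℕ-struct ρ a in
                ρ′ ⊩ numeralF k (wk o) (var fz) → ⟦ wk z ⟧ ρ′ ≡ a + ⟦ wk o ⟧ ρ′ → ⟦ z ⟧ ρ ≡ suc k
    successor a numeral e = begin
      ⟦ z ⟧ ρ       ≡⟨ sym (evalT-wk ℕ-struct ρ a z) ⟩
      ⟦ wk z ⟧ ρ′   ≡⟨ e ⟩
      a + ⟦ wk o ⟧ ρ′ ≡⟨ cong₂ _+_ (numeral⇒≡ k ρ′ (wk o) (var fz) o′≡1 numeral) o′≡1 ⟩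
      k + 1         ≡⟨ +-comm k 1 ⟩
      suc k         ∎
      where
      ρ′ = extend ℕ-struct ρ a
      o′≡1 = trans (evalT-wk ℕ-struct ρ a o) o≡1

  ≡⇒numeral : ∀ {m} k (ρ : Fin m → ℕ) o z →
              ⟦ o ⟧ ρ ≡ 1 → ⟦ z ⟧ ρ ≡ k → ρ ⊩ numeralF k o z
  ≡⇒numeral zero    ρ o z _   z≡0 = subst (λ v → v + v ≡ v) (sym z≡0) refl
  ≡⇒numeral (suc k) ρ o z o≡1 z≡1+k ¬numeral = ¬numeral k
    ( ≡⇒numeral k (extend ℕ-struct ρ k) (wk o) (var fz) o′≡1 refl
    , trans (evalT-wk ℕ-struct ρ k z) (trans z≡1+k (trans (+-comm 1 k) (cong (k +_) (sym o′≡1)))))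
    where
    o′≡1 = trans (evalT-wk ℕ-struct ρ k o) o≡1

  ≤⇒standard≤ : ∀ {m} n (ρ : Fin m → ℕ) o z →
                ⟦ o ⟧ ρ ≡ 1 → ⟦ z ⟧ ρ ≤ n → ρ ⊩ standard≤F n o z
  ≤⇒standard≤ zero    ρ o z o≡1 z≤0 = ≡⇒numeral zero ρ o z o≡1 (n≤0⇒n≡0 z≤0)
  ≤⇒standard≤ (suc n) ρ o z o≡1 z≤1+n ¬numeral with ⟦ z ⟧ ρ ≟ suc n
  ... | yes z≡1+n = ⊥-elim (¬numeral (≡⇒numeral (suc n) ρ o z o≡1 z≡1+n))
  ... | no  z≢1+n = ≤⇒standard≤ n ρ o z o≡1 (≤-pred (≤∧≢⇒< z≤1+n z≢1+n))

  zero-identityʳ-holds : ℕ-struct ⊨ zero-identityʳ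
  zero-identityʳ-holds y t isZero = trans (cong (y +_) (m+m≡m⇒m≡0 isZero)) (+-identityʳ y)

  one-unique-holds : ℕ-struct ⊨ one-unique
  one-unique-holds a b isOne-a isOne-b =
    trans (isOne⇒≡1 ρ (var (fs fz)) isOne-a) (sym (isOne⇒≡1 ρ (var fz) isOne-b))
    where ρ = extend ℕ-struct (extend ℕ-struct emptyEnv a) b

  V₂-small-near-holds : ∀ k → ℕ-struct ⊨ V₂-small-near k
  V₂-small-near-holds k o t y isOne numeral = conclude (V₂≤n⊎V₂[y+n]≤n (suc k) y)
    where
    ρ = extend ℕ-struct (extend ℕ-struct (extend ℕ-struct emptyEnv o) t) y
    o≡1 = isOne⇒≡1 ρ (var (fs (fs fz))) isOne
    t≡1+k = numeral⇒≡ (suc k) ρ (var (fs (fs fz))) (var (fs fz)) o≡1 numeral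

    standard≤ : Term 3 → Set
    standard≤ s = ρ ⊩ standard≤F (suc k) (var (fs (fs fz))) s

    conclude : V₂ y ≤ suc k ⊎ V₂ (y + suc k) ≤ suc k →
               ¬ standard≤ (V (plus (var fz) (var (fs fz)))) → standard≤ (V (var fz))
    conclude (inj₁ small-at-y)   _           = ≤⇒standard≤ (suc k) ρ _ _ o≡1 small-at-y
    conclude (inj₂ small-at-y+t) ¬standard≤ = ⊥-elim (¬standard≤ (≤⇒standard≤ (suc k) ρ _ _ o≡1
      (subst (λ u → V₂ (y + u) ≤ suc k) (sym t≡1+k) small-at-y+t)))

module InModel (𝔄 : Structure) where
  open Structure 𝔄
  open Std 𝔄

  ⟦_⟧ : ∀ {m} → Term m → (Fin m → Carrier) → Carrier
  ⟦ s ⟧ ρ = evalT 𝔄 ρ s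

  _⊩_ : ∀ {m} → (Fin m → Carrier) → Formula m → Set
  _⊩_ = Sat 𝔄

  isOne-wk : ∀ {m} (ρ : Fin m → Carrier) a o →
             IsOne (⟦ o ⟧ ρ) → IsOne (⟦ wk o ⟧ (extend 𝔄 ρ a))
  isOne-wk ρ a o = subst IsOne (sym (evalT-wk 𝔄 ρ a o))

  isOne⇒sat : ∀ {m} (ρ : Fin m → Carrier) s → IsOne (⟦ s ⟧ ρ) → ρ ⊩ isOneF s
  isOne⇒sat ρ s (nonzero , indecomposable) =
    nonzero , λ a b e → second (indecomposable a b (trans (sym (evalT-wk² 𝔄 ρ a b s)) e))
    where
    second : ∀ {a b} → IsZero a ⊎ IsZero b → ¬ IsZero a → IsZero b
    second (inj₁ zero-a) nonzero-a = ⊥-elim (nonzero-a zero-a)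
    second (inj₂ zero-b) _         = zero-b

  module _ (one-unique-𝔄 : ∀ a b → IsOne a → IsOne b → a ≡ b) where
    numeral⇒sat : ∀ {m} k (ρ : Fin m → Carrier) o z →
                  IsOne (⟦ o ⟧ ρ) → IsNumeral k (⟦ z ⟧ ρ) → ρ ⊩ numeralF k o z
    numeral⇒sat zero    ρ o z _     isZero = isZero
    numeral⇒sat (suc k) ρ o z isOne (y , o′ , numeral , isOne′ , z≡y+o′) ¬numeral = ¬numeral y
      ( numeral⇒sat k (extend 𝔄 ρ y) (wk o) (var fz) (isOne-wk ρ y o isOne) numeral
      , trans (evalT-wk 𝔄 ρ y z) (trans z≡y+o′ (cong (y ⊕_) o′≡o)))
      where
      o′≡o : o′ ≡ ⟦ wk o ⟧ (extend 𝔄 ρ y)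
      o′≡o = trans (one-unique-𝔄 o′ (⟦ o ⟧ ρ) isOne′ isOne) (sym (evalT-wk 𝔄 ρ y o))

  sat⇒numeral : ∀ {m} k (ρ : Fin m → Carrier) o z →
                IsOne (⟦ o ⟧ ρ) → ρ ⊩ numeralF k o z → ¬ ¬ IsNumeral k (⟦ z ⟧ ρ)
  sat⇒numeral zero    ρ o z _     isZero ¬numeral = ¬numeral isZero
  sat⇒numeral (suc k) ρ o z isOne ¬¬sat ¬numeral = ¬¬sat λ y (sat , e) → predecessor y sat e
    where
    predecessor : ∀ y → let ρ′ = extend 𝔄 ρ y in
                  ρ′ ⊩ numeralF k (wk o) (var fz) → ⟦ wk z ⟧ ρ′ ≡ y ⊕ ⟦ wk o ⟧ ρ′ → ⊥
    predecessor y sat e =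
      sat⇒numeral k (extend 𝔄 ρ y) (wk o) (var fz) (isOne-wk ρ y o isOne) sat λ numeral →
        ¬numeral (y , ⟦ o ⟧ ρ , numeral , isOne ,
        trans (sym (evalT-wk 𝔄 ρ y z)) (trans e (cong (y ⊕_) (evalT-wk 𝔄 ρ y o))))

  sat⇒standard : ∀ {m} n (ρ : Fin m → Carrier) o z →
                 IsOne (⟦ o ⟧ ρ) → ρ ⊩ standard≤F n o z → ¬ ¬ Standard (⟦ z ⟧ ρ)
  sat⇒standard zero    ρ o z isOne sat ¬standard =
    sat⇒numeral zero ρ o z isOne sat λ numeral → ¬standard (zero , numeral)
  sat⇒standard (suc n) ρ o z isOne sat ¬standard = sat⇒standard n ρ o z isOne
    (sat λ sat-1+n → sat⇒numeral (suc n) ρ o z isOne sat-1+n λ numeral → ¬standard (suc n , numeral))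
    ¬standard

  module _ (model : IsModelBA₂ 𝔄) where
    open InNat using (zero-identityʳ-holds; one-unique-holds; V₂-small-near-holds)

    one-unique-𝔄 : ∀ a b → IsOne a → IsOne b → a ≡ b
    one-unique-𝔄 a b isOne-a isOne-b = model one-unique one-unique-holds a b
      (isOne⇒sat ρ (var (fs fz)) isOne-a) (isOne⇒sat ρ (var fz) isOne-b)
      where ρ = extend 𝔄 (extend 𝔄 emptyEnv a) b

    V₂-nonstandard-apart : ∀ k y t → IsNumeral (suc k) t →
                           NonStandard (v2 (y ⊕ t)) → NonStandard (v2 y) → ⊥
    V₂-nonstandard-apart k y t numeral@(_ , o , _ , isOne , _) nonstandard-y+t nonstandard-y =
      sat⇒standard (suc k) ρ (var (fs (fs fz))) (V (var fz)) isOne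
        (small-near (λ small-at-y+t →
          sat⇒standard (suc k) ρ (var (fs (fs fz))) (V (plus (var fz) (var (fs fz)))) isOne
            small-at-y+t nonstandard-y+t))
        nonstandard-y
      where
      ρ = extend 𝔄 (extend 𝔄 (extend 𝔄 emptyEnv o) t) y
      small-near = model (V₂-small-near k) (V₂-small-near-holds k) o t y
        (isOne⇒sat ρ (var (fs (fs fz))) isOne)
        (numeral⇒sat one-unique-𝔄 (suc k) ρ (var (fs (fs fz))) (var (fs fz)) isOne numeral)

    hypernumbers-standard-apart : ∀ x y t → Standard t → x ≡ y ⊕ t →
                                  Hypernumber x → Hypernumber y → x ≡ y
    hypernumbers-standard-apart x y t (zero , isZero) x≡y+t _ _ =
      trans x≡y+t (model zero-identityʳ zero-identityʳ-holds y t isZero)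
    hypernumbers-standard-apart x y t (suc k , numeral) x≡y+t (_ , nonstandard-x) (_ , nonstandard-y) =
      ⊥-elim (V₂-nonstandard-apart k y t numeral
               (subst (NonStandard ∘ v2) x≡y+t nonstandard-x) nonstandard-y)

open InModel using (hypernumbers-standard-apart)

mainTheorem4 : (𝔄 : Structure) → Std.NonStandardModel 𝔄 →
    (x y : Structure.Carrier 𝔄) →
    Std.Hypernumber 𝔄 x → Std.Hypernumber 𝔄 y → Std._∼_ 𝔄 x y → x ≡ y
mainTheorem4 𝔄 (model , _) x y hx hy (_ , _ , t , standard , inj₁ x≡y+t) =
  hypernumbers-standard-apart 𝔄 model x y t standard x≡y+t hx hy
mainTheorem4 𝔄 (model , _) x y hx hy (_ , _ , t , standard , inj₂ y≡x+t) =
  sym (hypernumbers-standard-apart 𝔄 model y x t standard y≡x+t hy hx)
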